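{- Let $k,m$ be positive integers, $S_1,\dots,S_m\subseteq[k]\times[k]$ sets each containing at most one element from each row, and $G$ the graph constructed from them as described in the context. If there exists a set $\widehat S\subseteq[k]\times[k]$ containing exactly one element from each row with $\widehat S\cap S_s\neq\emptyset$ for every $s\in[m]$, then there exists a matching $M$ in $G$ with $|M|=3k+m$ such that $G[V_M]$ has exactly $k$ connected components.
   Context: A row of $[k]\times[k]$ is a set $\{i\}\times[k]$. Construction: let $P_i=\{i\}\times[k]$ for $i\in[k]$, and let $\mathcal{S}$ be the family consisting of the $m$ sets $S_1,\dots,S_m$ and the $k$ sets $P_1,\dots,P_k$ (treated as $k+m$ distinct members). The graph $H$ has vertices $v_i^L$ ($i\in[k]$), $v_j^R$ ($j\in[k]$), and for every $X\in\mathcal{S}$ and $(i,j)\in X$ a vertex $v_{i,j}^X$; its edges are $v_i^Lv_{i,j}^X$ and $v_{i,j}^Xv_j^R$ for all $X\in\mathcal{S}$ and $(i,j)\in X$. The graph $G$ is obtained from $H$ by adding, for each $i\in[k]$, a new vertex $u_i^L$ adjacent only to $v_i^L$; for each $j\in[k]$, a new vertex $u_j^R$ adjacent only to $v_j^R$; and for each $X\in\mathcal{S}$, a new vertex $u^X$ adjacent exactly to the vertices $v_{i,j}^X$, $(i,j)\in X$. For a matching $M$ (set of pairwise disjoint edges), $V_M$ is the set of endpoints of its edges and $G[V_M]$ the induced subgraph. -}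

module Defs where

open import Data.Nat using (ℕ; _+_; _*_; _≤_)
open import Data.Fin using (Fin; _≟_)
open import Relation.Nullary.Decidable using (⌊_⌋)
open import Data.Bool using (Bool; T)
open import Data.Sum using (_⊎_; inj₁; inj₂)
open import Data.Product using (Σ; ∃; ∃-syntax; _×_; _,_; proj₁; proj₂)
open import Data.List using (List; []; _∷_; concatMap; length)
open import Data.List.Relation.Unary.All using (All)
open import Data.List.Relation.Unary.Unique.Propositional using (Unique)
open import Data.List.Membership.Propositional using (_∈_)
open import Relation.Binary.PropositionalEquality using (_≡_)
open import Function.Bundles using (_⇔_)

-- A subset of [k] × [k] (rows/columns indexed by Fin k) given by its
-- characteristic function: (i , j) ∈ A  iff  T (A i j).
Subset² : ℕ → Set
Subset² k = Fin k → Fin k → Bool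

AtMostOnePerRow : ∀ {k} → Subset² k → Set
AtMostOnePerRow {k} A = ∀ (i j j′ : Fin k) → T (A i j) → T (A i j′) → j ≡ j′

ExactlyOnePerRow : ∀ {k} → Subset² k → Set
ExactlyOnePerRow {k} A =
  ∀ (i : Fin k) → Σ (Fin k) λ j → T (A i j) × (∀ (j′ : Fin k) → T (A i j′) → j′ ≡ j)

module Construction (k m : ℕ) (S : Fin m → Subset² k) where

  -- The family 𝒮 : inj₁ s is S_s, inj₂ i is the row P_i (k+m distinct members).
  Member : Set
  Member = Fin m ⊎ Fin k

  mem : Member → Fin k → Fin k → Bool
  mem (inj₁ s) i j = S s i j
  mem (inj₂ i′) i j = ⌊ i′ ≟ i ⌋

  data V : Set where
    vL : Fin k → V
    vR : Fin k → V
    vX : (X : Member) (i j : Fin k) → T (mem X i j) → V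
    uL : Fin k → V
    uR : Fin k → V
    uX : Member → V

  data E : V → V → Set where
    e-L  : ∀ X i j (p : T (mem X i j)) → E (vL i) (vX X i j p)
    e-R  : ∀ X i j (p : T (mem X i j)) → E (vX X i j p) (vR j)
    e-uL : ∀ i → E (uL i) (vL i)
    e-uR : ∀ j → E (uR j) (vR j)
    e-uX : ∀ X i j (p : T (mem X i j)) → E (uX X) (vX X i j p)

  Adj : V → V → Set
  Adj x y = E x y ⊎ E y x

  endpoints : List (V × V) → List V
  endpoints = concatMap (λ e → proj₁ e ∷ proj₂ e ∷ [])

  -- M is a matching of G: every pair is an edge of G and the endpoints of
  -- all edges are pairwise distinct (so edges are distinct and disjoint).
  IsMatching : List (V × V) → Set
  IsMatching M = All (λ e → Adj (proj₁ e) (proj₂ e)) M × Unique (endpoints M)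

  data Reach (W : V → Set) : V → V → Set where
    here : ∀ {x} → W x → Reach W x x
    step : ∀ {x y z} → Reach W x y → Adj y z → W z → Reach W x z

  -- G[W] has exactly n connected components: there is a surjective
  -- labelling of the vertices of W by Fin n whose fibres are exactly
  -- the connectivity classes.
  HasExactlyComponents : (V → Set) → ℕ → Set
  HasExactlyComponents W n =
    Σ ((x : V) → W x → Fin n) λ c →
      (∀ (t : Fin n) → Σ V λ x → Σ (W x) λ w → c x w ≡ t) ×
      (∀ x (wx : W x) y (wy : W y) → (c x wx ≡ c y wy) ⇔ Reach W x y)

module Submission where

-- Write Ŝ = {(i , σ i)} and let row s be a row where Ŝ meets S_s.  Match u^L_i
-- with v^L_i, u^R_j with v^R_j, and u^X with the vertex of X lying on Ŝ; this
-- gives 2k + (m + k) edges.  In G[V_M] every edge stays inside a column of Ŝ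
-- (v^L_i reaches only the P_i-vertex at (i , σ i)), and v^R_j joins everything
-- in column j, so the components are exactly the k columns.

open import Defs
open import Data.Nat using (ℕ; _+_; _*_; _≤_)
open import Data.Nat.Solver using (module +-*-Solver)
open import Data.Fin using (Fin; _≟_)
open import Data.Fin.Properties using (+↔⊎)
open import Data.Bool using (T)
open import Data.Sum using (_⊎_; inj₁; inj₂)
open import Data.Sum.Function.Propositional using (_⊎-↔_)
open import Data.Product using (Σ; _×_; _,_; proj₁; proj₂)
open import Data.List using (List; []; _∷_; length; map; allFin)
open import Data.List.Properties using (length-map; length-tabulate)
open import Data.List.Relation.Unary.All using (All; []; _∷_)
open import Data.List.Relation.Unary.AllPairs using ([]; _∷_)
open import Data.List.Relation.Unary.Any using (here; there)
open import Data.List.Relation.Unary.Unique.Propositional using (Unique)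
open import Data.List.Relation.Unary.Unique.Propositional.Properties using (allFin⁺; map⁺)
open import Data.List.Membership.Propositional using (_∈_)
open import Data.List.Membership.Propositional.Properties using (∈-allFin; ∈-map⁺)
open import Function using (_∘_)
open import Function.Bundles using (_↔_; mk⇔; Inverse; Injection)
open import Function.Properties.Inverse using (↔-refl; ↔-trans; ↔⇒↣)
open import Relation.Binary.PropositionalEquality
  using (_≡_; _≢_; refl; sym; trans; cong; subst)
open import Relation.Nullary.Decidable using (fromWitness)

module _ {k m : ℕ} {S : Fin m → Subset² k} where
  open Construction k m S

  Adj-sym : ∀ {x y} → Adj x y → Adj y x
  Adj-sym (inj₁ e) = inj₂ e
  Adj-sym (inj₂ e) = inj₁ e

  module _ {W : V → Set} where

    Reach-target : ∀ {x y} → Reach W x y → W y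
    Reach-target (here wx)     = wx
    Reach-target (step _ _ wz) = wz

    Reach-trans : ∀ {x y z} → Reach W x y → Reach W y z → Reach W x z
    Reach-trans r (here _)      = r
    Reach-trans r (step r′ a w) = step (Reach-trans r r′) a w

    Reach-sym : ∀ {x y} → Reach W x y → Reach W y x
    Reach-sym (here wx)     = here wx
    Reach-sym (step r a wz) =
      Reach-trans (step (here wz) (Adj-sym a) (Reach-target r)) (Reach-sym r)

    Reach-invariant : ∀ {A : Set} (f : V → A) →
                      (∀ {x y} → W x → W y → Adj x y → f x ≡ f y) →
                      ∀ {x y} → W x → Reach W x y → f x ≡ f y
    Reach-invariant _ _     _  (here _)      = refl
    Reach-invariant f f-adj wx (step r a wz) =
      trans (Reach-invariant f f-adj wx r) (f-adj (Reach-target r) wz a)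

module Transversal (k m : ℕ) (S : Fin m → Subset² k) (σ : Fin k → Fin k)
                   (row : Fin m → Fin k) (hits : ∀ s → T (S s (row s) (σ (row s)))) where
  open Construction k m S

  rowOf : Member → Fin k
  rowOf (inj₁ s) = row s
  rowOf (inj₂ i) = i

  rowOf-hits : ∀ X → T (mem X (rowOf X) (σ (rowOf X)))
  rowOf-hits (inj₁ s) = hits s
  rowOf-hits (inj₂ i) = fromWitness {a? = i ≟ i} refl

  centre : Member → V
  centre X = vX X (rowOf X) (σ (rowOf X)) (rowOf-hits X)

  Tag : Set
  Tag = Fin k ⊎ Fin k ⊎ Member

  core : Tag → V
  core (inj₁ i)         = vL i
  core (inj₂ (inj₁ j))  = vR j
  core (inj₂ (inj₂ X))  = centre X

  pendant : Tag → V
  pendant (inj₁ i)        = uL i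
  pendant (inj₂ (inj₁ j)) = uR j
  pendant (inj₂ (inj₂ X)) = uX X

  pendant-adj-core : ∀ t → Adj (pendant t) (core t)
  pendant-adj-core (inj₁ i)        = inj₁ (e-uL i)
  pendant-adj-core (inj₂ (inj₁ j)) = inj₁ (e-uR j)
  pendant-adj-core (inj₂ (inj₂ X)) = inj₁ (e-uX X _ _ (rowOf-hits X))

  tagOf : V → Tag
  tagOf (vL i)       = inj₁ i
  tagOf (vR j)       = inj₂ (inj₁ j)
  tagOf (vX X _ _ _) = inj₂ (inj₂ X)
  tagOf (uL i)       = inj₁ i
  tagOf (uR j)       = inj₂ (inj₁ j)
  tagOf (uX X)       = inj₂ (inj₂ X)

  tagOf-pendant : ∀ t → tagOf (pendant t) ≡ t
  tagOf-pendant (inj₁ i)        = refl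
  tagOf-pendant (inj₂ (inj₁ j)) = refl
  tagOf-pendant (inj₂ (inj₂ X)) = refl

  tagOf-core : ∀ t → tagOf (core t) ≡ t
  tagOf-core (inj₁ i)        = refl
  tagOf-core (inj₂ (inj₁ j)) = refl
  tagOf-core (inj₂ (inj₂ X)) = refl

  pendant≢core : ∀ t → pendant t ≢ core t
  pendant≢core (inj₁ i)        ()
  pendant≢core (inj₂ (inj₁ j)) ()
  pendant≢core (inj₂ (inj₂ X)) ()

  pendantEdge : Tag → V × V
  pendantEdge t = pendant t , core t

  pendantEdges-Adj : ∀ ts → All (λ e → Adj (proj₁ e) (proj₂ e)) (map pendantEdge ts)
  pendantEdges-Adj []       = []
  pendantEdges-Adj (t ∷ ts) = pendant-adj-core t ∷ pendantEdges-Adj ts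

  endpoints-avoid : ∀ {x t ts} → tagOf x ≡ t → All (t ≢_) ts →
                    All (x ≢_) (endpoints (map pendantEdge ts))
  endpoints-avoid             x↦t []                   = []
  endpoints-avoid {ts = t′ ∷ _} x↦t (t≢t′ ∷ t∉ts) =
    (λ x≡p → t≢t′ (trans (sym x↦t) (trans (cong tagOf x≡p) (tagOf-pendant t′)))) ∷
    (λ x≡c → t≢t′ (trans (sym x↦t) (trans (cong tagOf x≡c) (tagOf-core t′)))) ∷
    endpoints-avoid x↦t t∉ts

  endpoints-Unique : ∀ {ts} → Unique ts → Unique (endpoints (map pendantEdge ts))
  endpoints-Unique []                     = []
  endpoints-Unique {t ∷ _} (t∉ts ∷ uniq) =
    (pendant≢core t ∷ endpoints-avoid (tagOf-pendant t) t∉ts) ∷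
    endpoints-avoid (tagOf-core t) t∉ts ∷
    endpoints-Unique uniq

  ∈-endpoints⁺ : ∀ {t ts} → t ∈ ts →
                 pendant t ∈ endpoints (map pendantEdge ts) × core t ∈ endpoints (map pendantEdge ts)
  ∈-endpoints⁺ (here refl) = here refl , there (here refl)
  ∈-endpoints⁺ (there t∈) with ∈-endpoints⁺ t∈
  ... | p∈ , c∈ = there (there p∈) , there (there c∈)

  ∈-endpoints⁻ : ∀ {x} ts → x ∈ endpoints (map pendantEdge ts) →
                 Σ Tag λ t → x ≡ pendant t ⊎ x ≡ core t
  ∈-endpoints⁻ (t ∷ ts) (here x≡p)         = t , inj₁ x≡p
  ∈-endpoints⁻ (t ∷ ts) (there (here x≡c)) = t , inj₂ x≡c
  ∈-endpoints⁻ (t ∷ ts) (there (there x∈)) = ∈-endpoints⁻ ts x∈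

  N : ℕ
  N = k + (k + (m + k))

  indexing : Fin N ↔ Tag
  indexing = ↔-trans +↔⊎ (↔-refl ⊎-↔ ↔-trans +↔⊎ (↔-refl ⊎-↔ +↔⊎))

  tags : List Tag
  tags = map (Inverse.to indexing) (allFin N)

  tags-Unique : Unique tags
  tags-Unique = map⁺ (Injection.injective (↔⇒↣ indexing)) (allFin⁺ N)

  ∈-tags : ∀ t → t ∈ tags
  ∈-tags t = subst (_∈ tags) (Inverse.strictlyInverseˡ indexing t)
                   (∈-map⁺ (Inverse.to indexing) (∈-allFin (Inverse.from indexing t)))

  length-tags : length tags ≡ 3 * k + m
  length-tags = trans (length-map _ (allFin N)) (trans (length-tabulate _) (arith k m))
    where
    open +-*-Solver
    arith : ∀ k m → k + (k + (m + k)) ≡ 3 * k + m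
    arith = solve 2 (λ k m → k :+ (k :+ (m :+ k)) := con 3 :* k :+ m) refl

  M : List (V × V)
  M = map pendantEdge tags

  M-IsMatching : IsMatching M
  M-IsMatching = pendantEdges-Adj tags , endpoints-Unique tags-Unique

  length-M : length M ≡ 3 * k + m
  length-M = trans (length-map pendantEdge tags) length-tags

  V_M : V → Set
  V_M x = x ∈ endpoints M

  pendant∈V_M : ∀ t → V_M (pendant t)
  pendant∈V_M t = proj₁ (∈-endpoints⁺ (∈-tags t))

  core∈V_M : ∀ t → V_M (core t)
  core∈V_M t = proj₂ (∈-endpoints⁺ (∈-tags t))

  vX∈V_M⇒centre : ∀ {X i j p} → V_M (vX X i j p) → i ≡ rowOf X × j ≡ σ i
  vX∈V_M⇒centre x∈ with ∈-endpoints⁻ tags x∈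
  ... | inj₁ _        , inj₁ ()
  ... | inj₂ (inj₁ _) , inj₁ ()
  ... | inj₂ (inj₂ _) , inj₁ ()
  ... | inj₁ _        , inj₂ ()
  ... | inj₂ (inj₁ _) , inj₂ ()
  ... | inj₂ (inj₂ _) , inj₂ refl = refl , refl

  column : V → Fin k
  column (vL i)       = σ i
  column (vR j)       = j
  column (vX _ _ j _) = j
  column (uL i)       = σ i
  column (uR j)       = j
  column (uX X)       = σ (rowOf X)

  column-E : ∀ {x y} → V_M x → V_M y → E x y → column x ≡ column y
  column-E _ y∈ (e-L X i j p) = sym (proj₂ (vX∈V_M⇒centre y∈))
  column-E _ _  (e-R X i j p) = refl
  column-E _ _  (e-uL i)      = refl
  column-E _ _  (e-uR j)      = refl
  column-E _ y∈ (e-uX X i j p) with vX∈V_M⇒centre y∈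
  ... | refl , j≡σi = sym j≡σi

  column-Adj : ∀ {x y} → V_M x → V_M y → Adj x y → column x ≡ column y
  column-Adj x∈ y∈ (inj₁ e) = column-E x∈ y∈ e
  column-Adj x∈ y∈ (inj₂ e) = sym (column-E y∈ x∈ e)

  core-reaches-column : ∀ t → Reach V_M (core t) (vR (column (core t)))
  core-reaches-column (inj₁ i) =
    step (step (here (core∈V_M (inj₁ i))) (inj₁ (e-L P i (σ i) _)) (core∈V_M (inj₂ (inj₂ P))))
         (inj₁ (e-R P i (σ i) _)) (core∈V_M (inj₂ (inj₁ (σ i))))
    where P = inj₂ i
  core-reaches-column (inj₂ (inj₁ j)) = here (core∈V_M (inj₂ (inj₁ j)))
  core-reaches-column (inj₂ (inj₂ X)) =
    step (here (core∈V_M (inj₂ (inj₂ X)))) (inj₁ (e-R X _ _ (rowOf-hits X)))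
         (core∈V_M (inj₂ (inj₁ (σ (rowOf X)))))

  reaches-column : ∀ {x} → V_M x → Reach V_M x (vR (column x))
  reaches-column x∈ with ∈-endpoints⁻ tags x∈
  ... | t , inj₂ refl = core-reaches-column t
  ... | t , inj₁ refl =
    Reach-trans (step (here (pendant∈V_M t)) (pendant-adj-core t) (core∈V_M t))
                (subst (λ c → Reach V_M (core t) (vR c)) (column-pendant t) (core-reaches-column t))
    where
    column-pendant : ∀ t → column (core t) ≡ column (pendant t)
    column-pendant (inj₁ i)        = refl
    column-pendant (inj₂ (inj₁ j)) = refl
    column-pendant (inj₂ (inj₂ X)) = refl

  V_M-components : HasExactlyComponents V_M k
  V_M-components =
    (λ x _ → column x) ,
    (λ j → vR j , core∈V_M (inj₂ (inj₁ j)) , refl) ,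
    λ x x∈ y y∈ → mk⇔
      (λ same → Reach-trans (reaches-column x∈)
                  (subst (λ c → Reach V_M (vR c) y) (sym same) (Reach-sym (reaches-column y∈))))
      (Reach-invariant column column-Adj x∈)

lemma7 : (k m : ℕ) → 1 ≤ k → 1 ≤ m →
    (S : Fin m → Subset² k) → (∀ s → AtMostOnePerRow (S s)) →
    (Σ (Subset² k) λ Ŝ → ExactlyOnePerRow Ŝ ×
    (∀ (s : Fin m) → Σ (Fin k) λ i → Σ (Fin k) λ j → T (Ŝ i j) × T (S s i j))) →
    Σ (List (Construction.V k m S × Construction.V k m S)) λ M →
    Construction.IsMatching k m S M ×
    length M ≡ 3 * k + m ×
    Construction.HasExactlyComponents k m S (λ x → x ∈ Construction.endpoints k m S M) k
lemma7 k m _ _ S _ (Ŝ , oneEach , meets) = M , M-IsMatching , length-M , V_M-components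
  where
  σ : Fin k → Fin k
  σ i = proj₁ (oneEach i)

  row : Fin m → Fin k
  row s = proj₁ (meets s)

  hits : ∀ s → T (S s (row s) (σ (row s)))
  hits s with meets s
  ... | i , j , ij∈Ŝ , ij∈S = subst (T ∘ S s i) (proj₂ (proj₂ (oneEach i)) j ij∈Ŝ) ij∈S

  open Transversal k m S σ row hits
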